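{- For every $d\geq2$, $\mathcal D_2(U_d)=\omega_{2d}^*$, where $\omega_{2d}^*=\{\pm\mathbf e_1,\dots,\pm\mathbf e_d\}$ and $U_d=\{(\pm\frac1{\sqrt d},\dots,\pm\frac1{\sqrt d})\}\subset\mathbb R^d$ (all $2^d$ sign choices).
   Context: $\mathbf e_1,\dots,\mathbf e_d$ is the standard basis of $\mathbb R^d$; $S^{d-1}$ is the unit sphere in $\mathbb R^d$. For a finite configuration $\omega=\{\mathbf x_1,\dots,\mathbf x_N\}\subset S^{d-1}$, $\mathcal D_m(\omega)$ is the set of all $\mathbf z\in S^{d-1}$ such that $\{\mathbf z\cdot\mathbf x_i\}$ has at most $m$ distinct elements. -}

module Defs where

open import Level using (0ℓ)
open import Data.Nat using (ℕ; zero; suc)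
open import Data.Fin using (Fin; zero; suc; _≟_)
open import Data.Bool using (Bool; true; false; if_then_else_)
open import Data.List using (List; length)
open import Data.List.Membership.Propositional using (_∈_)
open import Data.Product using (Σ; ∃; _×_; _,_)
open import Data.Sum using (_⊎_)
open import Relation.Nullary using (¬_; yes; no)
open import Relation.Binary.PropositionalEquality using (_≡_)
open import Relation.Binary.Structures using (IsStrictTotalOrder)
open import Algebra.Structures using (IsCommutativeRing)
import Data.Nat as N

-- An axiomatisation of the real numbers: a Dedekind-complete ordered field
-- (unique up to isomorphism), with equality the propositional equality.
record RealNumbers : Set₁ where
  infixl 6 _+_
  infixl 7 _*_
  infix 4 _<_ _≤_
  field
    ℝ   : Set
    _+_ : ℝ → ℝ → ℝ
    _*_ : ℝ → ℝ → ℝ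
    -_  : ℝ → ℝ
    0#  : ℝ
    1#  : ℝ
    _<_ : ℝ → ℝ → Set
    isCommutativeRing : IsCommutativeRing _≡_ _+_ _*_ -_ 0# 1#
    0≢1   : ¬ (0# ≡ 1#)
    inverse : ∀ x → ¬ (x ≡ 0#) → Σ ℝ λ y → x * y ≡ 1#
    isStrictTotalOrder : IsStrictTotalOrder _≡_ _<_
    +-mono-< : ∀ {x y} z → x < y → x + z < y + z
    *-pos    : ∀ {x y} → 0# < x → 0# < y → 0# < x * y
  _≤_ : ℝ → ℝ → Set
  x ≤ y = x < y ⊎ x ≡ y
  field
    complete : (P : ℝ → Set) → Σ ℝ P → Σ ℝ (λ b → ∀ x → P x → x ≤ b) →
               Σ ℝ λ s → (∀ x → P x → x ≤ s) ×
                         (∀ b → (∀ x → P x → x ≤ b) → s ≤ b)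

module Geometry (R : RealNumbers) where
  open RealNumbers R public

  Point : ℕ → Set
  Point d = Fin d → ℝ

  sumF : ∀ {n} → (Fin n → ℝ) → ℝ
  sumF {zero}  f = 0#
  sumF {suc n} f = f zero + sumF (λ i → f (suc i))

  _·_ : ∀ {d} → Point d → Point d → ℝ
  x · y = sumF (λ i → x i * y i)

  OnSphere : ∀ {d} → Point d → Set
  OnSphere z = z · z ≡ 1#

  fromℕ : ℕ → ℝ
  fromℕ zero    = 0#
  fromℕ (suc n) = 1# + fromℕ n

  e : ∀ {d} → Fin d → Point d
  e i j with i ≟ j
  ... | yes _ = 1#
  ... | no  _ = 0#

  AtMostDistinct : {I : Set} → ℕ → (I → ℝ) → Set
  AtMostDistinct {I} m f = Σ (List ℝ) λ L → (length L N.≤ m) × (∀ i → f i ∈ L)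

  -- D_m(ω) for a finite configuration ω given as a family x : I → S^{d-1}
  InD : ∀ {d} {I : Set} → ℕ → (I → Point d) → Point d → Set
  InD m x z = OnSphere z × AtMostDistinct m (λ i → z · x i)

  -- U_d : indexed by the 2^d sign choices s : Fin d → Bool;
  -- c is the scalar 1/√d (characterised by c > 0, c·c·d = 1)
  U : ∀ {d} → ℝ → (Fin d → Bool) → Point d
  U c s i = if s i then c else (- c)

  InCrossPolytope : ∀ {d} → Point d → Set
  InCrossPolytope {d} z =
    Σ (Fin d) λ i → (∀ j → z j ≡ e i j) ⊎ (∀ j → z j ≡ - e i j)

-- If z had two nonzero coordinates i ≠ j, flipping the sign of a sign vector at i (resp. j)
-- would shift z · u by a = 2c zᵢ (resp. b = 2c zⱼ), so the four sign vectors obtained from the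
-- all-plus one by flipping at neither, i, j, or both would give values p, p − a, p − b, p − a − b.
-- With a, b ≠ 0, only two distinct values would force a = b and a + b = 0, so zᵢ = 0.
-- Hence z lives on one coordinate, where the sphere condition gives ±1. Conversely ±eᵢ
-- takes only the values ±c on U_d.
module Submission where

open import Defs
open import Data.Nat using (ℕ; zero; suc; s≤s; z≤n) renaming (_≤_ to _≤ℕ_)
open import Data.Fin using (Fin; zero; suc) renaming (_≟_ to _≟ᶠ_)
open import Data.Fin.Properties using (suc-injective; all?; ¬∀⟶∃¬)
open import Data.Vec.Functional using (updateAt)
open import Data.Vec.Functional.Properties using (updateAt-updates; updateAt-minimal)
open import Data.Bool using (Bool; true; false; if_then_else_)
open import Data.List using ([]; _∷_)
open import Data.List.Membership.Propositional using (_∈_)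
open import Data.List.Relation.Unary.Any using (here; there)
open import Data.Product using (Σ; _×_; _,_)
open import Data.Sum using (_⊎_; inj₁; inj₂)
open import Data.Empty using (⊥-elim)
open import Function using (const; _∘_)
open import Level using (0ℓ)
open import Relation.Nullary using (¬_; yes; no)
open import Relation.Binary.PropositionalEquality
  using (_≡_; _≢_; refl; sym; trans; cong; cong₂; subst; module ≡-Reasoning)
open import Relation.Binary.Structures using (IsStrictTotalOrder)
open import Algebra.Bundles using (CommutativeRing)
import Algebra.Properties.Ring as RingProperties
import Algebra.Properties.CommutativeSemigroup as CommutativeSemigroupProperties

module _ (R : RealNumbers) where
  open Geometry R

  private
    commutativeRing : CommutativeRing 0ℓ 0ℓ
    commutativeRing = record { isCommutativeRing = isCommutativeRing }

  open CommutativeRing commutativeRing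
    using ( +-assoc; +-identityˡ; -‿inverseˡ; -‿inverseʳ; *-assoc; *-identityˡ; *-identityʳ
          ; distribˡ; distribʳ; zeroˡ; ring; +-commutativeSemigroup )
  open RingProperties ring
    using ( +-cancelˡ; +-identityʳ-unique; +-inverseˡ-unique; -‿involutive; -0#≈0#
          ; -1*x≈-x; x[y-z]≈xy-xz; ⁻¹-anti-homo‿- )
  open CommutativeSemigroupProperties +-commutativeSemigroup using (xy∙z≈xz∙y)
  open IsStrictTotalOrder isStrictTotalOrder using (irrefl; _≟_) renaming (trans to <-trans)
  open ≡-Reasoning

  0<x⇒x≢0 : ∀ {x} → 0# < x → x ≢ 0#
  0<x⇒x≢0 0<x x≡0 = irrefl (sym x≡0) 0<x

  0<x⇒0<x+x : ∀ {x} → 0# < x → 0# < x + x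
  0<x⇒0<x+x {x} 0<x = <-trans 0<x (subst (_< x + x) (+-identityˡ x) (+-mono-< x 0<x))

  x*y≡0⇒x≡0 : ∀ {x y} → y ≢ 0# → x * y ≡ 0# → x ≡ 0#
  x*y≡0⇒x≡0 {x} {y} y≢0 xy≡0 with inverse y y≢0
  ... | y⁻¹ , yy⁻¹≡1 = begin
    x              ≡⟨ sym (*-identityʳ x) ⟩
    x * 1#         ≡⟨ cong (x *_) (sym yy⁻¹≡1) ⟩
    x * (y * y⁻¹)  ≡⟨ sym (*-assoc x y y⁻¹) ⟩
    x * y * y⁻¹    ≡⟨ cong (_* y⁻¹) xy≡0 ⟩
    0# * y⁻¹       ≡⟨ zeroˡ y⁻¹ ⟩
    0#             ∎

  x*y≡0⇒x≡0⊎y≡0 : ∀ {x y} → x * y ≡ 0# → x ≡ 0# ⊎ y ≡ 0#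
  x*y≡0⇒x≡0⊎y≡0 {y = y} xy≡0 with y ≟ 0#
  ... | yes y≡0 = inj₂ y≡0
  ... | no  y≢0 = inj₁ (x*y≡0⇒x≡0 y≢0 xy≡0)

  PlusMinusOne : ℝ → Set
  PlusMinusOne x = x ≡ 1# ⊎ x ≡ - 1#

  x*x≡1⇒±1 : ∀ x → x * x ≡ 1# → PlusMinusOne x
  x*x≡1⇒±1 x xx≡1 with x*y≡0⇒x≡0⊎y≡0 factored
    where
    factored : (x + 1#) * (x + - 1#) ≡ 0#
    factored = begin
      (x + 1#) * (x + - 1#)                  ≡⟨ distribʳ (x + - 1#) x 1# ⟩
      x * (x + - 1#) + 1# * (x + - 1#)       ≡⟨ cong₂ _+_ (x[y-z]≈xy-xz x x 1#) (*-identityˡ _) ⟩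
      (x * x + - (x * 1#)) + (x + - 1#)      ≡⟨ cong₂ (λ a b → (a + - b) + (x + - 1#)) xx≡1 (*-identityʳ x) ⟩
      (1# + - x) + (x + - 1#)                ≡⟨ cong ((1# + - x) +_) (sym (⁻¹-anti-homo‿- 1# x)) ⟩
      (1# + - x) + - (1# + - x)              ≡⟨ -‿inverseʳ _ ⟩
      0#                                     ∎
  ... | inj₁ x+1≡0 = inj₂ (+-inverseˡ-unique x 1# x+1≡0)
  ... | inj₂ x-1≡0 = inj₁ (trans (+-inverseˡ-unique x (- 1#) x-1≡0) (-‿involutive 1#))

  ±1⇒x*x≡1 : ∀ {x} → PlusMinusOne x → x * x ≡ 1#
  ±1⇒x*x≡1 (inj₁ refl) = *-identityˡ 1#
  ±1⇒x*x≡1 (inj₂ refl) = trans (-1*x≈-x (- 1#)) (-‿involutive 1#)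

  sumF-cong : ∀ {n} {f g : Fin n → ℝ} → (∀ k → f k ≡ g k) → sumF f ≡ sumF g
  sumF-cong {zero}  f≗g = refl
  sumF-cong {suc n} f≗g = cong₂ _+_ (f≗g zero) (sumF-cong (f≗g ∘ suc))

  sumF-zero : ∀ n → sumF {n} (const 0#) ≡ 0#
  sumF-zero zero    = refl
  sumF-zero (suc n) = trans (cong (0# +_) (sumF-zero n)) (+-identityˡ 0#)

  sumF-agreeOff : ∀ {n} {f g : Fin n → ℝ} (i : Fin n) {x : ℝ} →
                  (∀ k → k ≢ i → f k ≡ g k) → f i ≡ g i + x → sumF f ≡ sumF g + x
  sumF-agreeOff {f = f} {g} zero {x} agree fᵢ≡gᵢ+x = begin
    f zero + sumF (f ∘ suc)        ≡⟨ cong₂ _+_ fᵢ≡gᵢ+x (sumF-cong (λ k → agree (suc k) λ ())) ⟩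
    (g zero + x) + sumF (g ∘ suc)  ≡⟨ xy∙z≈xz∙y (g zero) x (sumF (g ∘ suc)) ⟩
    (g zero + sumF (g ∘ suc)) + x  ∎
  sumF-agreeOff {f = f} {g} (suc i) {x} agree fᵢ≡gᵢ+x = begin
    f zero + sumF (f ∘ suc)          ≡⟨ cong₂ _+_ (agree zero λ ())
                                          (sumF-agreeOff i (λ k k≢i → agree (suc k) (k≢i ∘ suc-injective)) fᵢ≡gᵢ+x) ⟩
    g zero + (sumF (g ∘ suc) + x)    ≡⟨ sym (+-assoc (g zero) (sumF (g ∘ suc)) x) ⟩
    (g zero + sumF (g ∘ suc)) + x    ∎

  sumF-single : ∀ {n} (f : Fin n → ℝ) (i : Fin n) → (∀ k → k ≢ i → f k ≡ 0#) → sumF f ≡ f i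
  sumF-single {n} f i vanish = begin
    sumF f                     ≡⟨ sumF-agreeOff i vanish (sym (+-identityˡ (f i))) ⟩
    sumF {n} (const 0#) + f i  ≡⟨ cong (_+ f i) (sumF-zero n) ⟩
    0# + f i                   ≡⟨ +-identityˡ (f i) ⟩
    f i                        ∎

  ∈-pair : ∀ {x a b : ℝ} → x ∈ a ∷ b ∷ [] → x ≡ a ⊎ x ≡ b
  ∈-pair (here x≡a)         = inj₁ x≡a
  ∈-pair (there (here x≡b)) = inj₂ x≡b

  atMost2-collide : ∀ {I : Set} {f : I → ℝ} → AtMostDistinct 2 f →
                    ∀ p q r → f p ≡ f q ⊎ f p ≡ f r ⊎ f q ≡ f r
  atMost2-collide ([] , _ , mem) p q r with mem p
  ... | ()
  atMost2-collide (a ∷ [] , _ , mem) p q r with mem p | mem q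
  ... | here fp≡a | here fq≡a = inj₁ (trans fp≡a (sym fq≡a))
  atMost2-collide (a ∷ b ∷ [] , _ , mem) p q r with ∈-pair (mem p) | ∈-pair (mem q) | ∈-pair (mem r)
  ... | inj₁ fp≡a | inj₁ fq≡a | _         = inj₁ (trans fp≡a (sym fq≡a))
  ... | inj₂ fp≡b | inj₂ fq≡b | _         = inj₁ (trans fp≡b (sym fq≡b))
  ... | inj₁ fp≡a | inj₂ _    | inj₁ fr≡a = inj₂ (inj₁ (trans fp≡a (sym fr≡a)))
  ... | inj₂ fp≡b | inj₁ _    | inj₂ fr≡b = inj₂ (inj₁ (trans fp≡b (sym fr≡b)))
  ... | inj₁ _    | inj₂ fq≡b | inj₂ fr≡b = inj₂ (inj₂ (trans fq≡b (sym fr≡b)))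
  ... | inj₂ _    | inj₁ fq≡a | inj₁ fr≡a = inj₂ (inj₂ (trans fq≡a (sym fr≡a)))
  atMost2-collide (_ ∷ _ ∷ _ ∷ _ , s≤s (s≤s ()) , _) p q r

  x≡y+d⇒x≢y : ∀ {x y d} → d ≢ 0# → x ≡ y + d → x ≢ y
  x≡y+d⇒x≢y {y = y} {d} d≢0 x≡y+d x≡y = d≢0 (+-identityʳ-unique y d (trans (sym x≡y+d) x≡y))

  atMost2-square : ∀ {I : Set} {f : I → ℝ} {a b : ℝ} → AtMostDistinct 2 f → a ≢ 0# → b ≢ 0# →
                   ∀ p q r s → f p ≡ f q + a → f p ≡ f r + b → f q ≡ f s + b → a + a ≡ 0#
  atMost2-square {f = f} {a} {b} amd a≢0 b≢0 p q r s fp≡fq+a fp≡fr+b fq≡fs+b =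
    +-identityʳ-unique (f s) (a + a) (begin
      f s + (a + a)  ≡⟨ cong (λ t → f s + (t + a)) a≡b ⟩
      f s + (b + a)  ≡⟨ sym (+-assoc (f s) b a) ⟩
      f s + b + a    ≡⟨ cong (_+ a) (sym fq≡fs+b) ⟩
      f q + a        ≡⟨ sym fp≡fq+a ⟩
      f p            ≡⟨ fp≡fs ⟩
      f s            ∎)
    where
    fp≢fq : f p ≢ f q
    fp≢fq = x≡y+d⇒x≢y a≢0 fp≡fq+a
    a≡b : a ≡ b
    a≡b with atMost2-collide amd p q r
    ... | inj₁ fp≡fq = ⊥-elim (fp≢fq fp≡fq)
    ... | inj₂ (inj₁ fp≡fr) = ⊥-elim (x≡y+d⇒x≢y b≢0 fp≡fr+b fp≡fr)
    ... | inj₂ (inj₂ fq≡fr) = +-cancelˡ (f r) a b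
                                (trans (cong (_+ a) (sym fq≡fr)) (trans (sym fp≡fq+a) fp≡fr+b))
    fp≡fs : f p ≡ f s
    fp≡fs with atMost2-collide amd p q s
    ... | inj₁ fp≡fq = ⊥-elim (fp≢fq fp≡fq)
    ... | inj₂ (inj₁ fp≡fs) = fp≡fs
    ... | inj₂ (inj₂ fq≡fs) = ⊥-elim (x≡y+d⇒x≢y b≢0 fq≡fs+b fq≡fs)

  SupportedAt : ∀ {d} → Point d → Fin d → Set
  SupportedAt z i = ∀ k → k ≢ i → z k ≡ 0#

  ·-supportedAt : ∀ {d} {z : Point d} {i} → SupportedAt z i → ∀ y → z · y ≡ z i * y i
  ·-supportedAt {z = z} {i} supp y =
    sumF-single (λ k → z k * y k) i (λ k k≢i → trans (cong (_* y k) (supp k k≢i)) (zeroˡ (y k)))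

  ·U-flip : ∀ {d} (c : ℝ) (z : Point d) (s : Fin d → Bool) (i : Fin d) → s i ≡ true →
            z · U c s ≡ z · U c (updateAt s i (const false)) + z i * (c + c)
  ·U-flip c z s i sᵢ≡true = sumF-agreeOff i agree (begin
      z i * U c s i               ≡⟨ cong (λ b → z i * (if b then c else - c)) sᵢ≡true ⟩
      z i * c                     ≡⟨ cong (z i *_) (sym -c+[c+c]≡c) ⟩
      z i * (- c + (c + c))       ≡⟨ distribˡ (z i) (- c) (c + c) ⟩
      z i * - c + z i * (c + c)   ≡⟨ cong (λ b → z i * (if b then c else - c) + z i * (c + c))
                                       (sym (updateAt-updates i s)) ⟩
      z i * U c (updateAt s i (const false)) i + z i * (c + c) ∎)
    where
    agree : ∀ k → k ≢ i → z k * U c s k ≡ z k * U c (updateAt s i (const false)) k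
    agree k k≢i = cong (λ b → z k * (if b then c else - c)) (sym (updateAt-minimal k i s k≢i))
    -c+[c+c]≡c : - c + (c + c) ≡ c
    -c+[c+c]≡c = begin
      - c + (c + c)  ≡⟨ sym (+-assoc (- c) c c) ⟩
      (- c + c) + c  ≡⟨ cong (_+ c) (-‿inverseˡ c) ⟩
      0# + c         ≡⟨ +-identityˡ c ⟩
      c              ∎

  twoNonzero⇒¬atMost2 : ∀ {d} {c : ℝ} (z : Point d) → 0# < c → ∀ {i j} → i ≢ j →
                        z i ≢ 0# → z j ≢ 0# → ¬ AtMostDistinct 2 (λ s → z · U c s)
  twoNonzero⇒¬atMost2 {c = c} z 0<c {i} {j} i≢j zᵢ≢0 zⱼ≢0 amd =
    zᵢ≢0 (x*y≡0⇒x≡0 (0<x⇒x≢0 (0<x⇒0<x+x 0<2c))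
           (trans (distribˡ (z i) (c + c) (c + c)) square))
    where
    0<2c : 0# < c + c
    0<2c = 0<x⇒0<x+x 0<c
    scaled≢0 : ∀ {x} → x ≢ 0# → x * (c + c) ≢ 0#
    scaled≢0 x≢0 = x≢0 ∘ x*y≡0⇒x≡0 (0<x⇒x≢0 0<2c)
    plus minusᵢ : Fin _ → Bool
    plus   = const true
    minusᵢ = updateAt plus i (const false)
    square : z i * (c + c) + z i * (c + c) ≡ 0#
    square = atMost2-square amd (scaled≢0 zᵢ≢0) (scaled≢0 zⱼ≢0)
      plus minusᵢ (updateAt plus j (const false)) (updateAt minusᵢ j (const false))
      (·U-flip c z plus i refl) (·U-flip c z plus j refl)
      (·U-flip c z minusᵢ j (updateAt-minimal j i plus (i≢j ∘ sym)))

  SignedBasisVector : ∀ {d} → Point d → Set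
  SignedBasisVector {d} z = Σ (Fin d) λ i → SupportedAt z i × PlusMinusOne (z i)

  inD2⇒signedBasisVector : ∀ {d} {c : ℝ} {z : Point d} → 0# < c → InD 2 (U c) z → SignedBasisVector z
  inD2⇒signedBasisVector {d} {c} {z} 0<c (z·z≡1 , amd) with all? (λ k → z k ≟ 0#)
  ... | yes z≗0 = ⊥-elim (0≢1 (trans (sym z·z≡0) z·z≡1))
    where
    z·z≡0 : z · z ≡ 0#
    z·z≡0 = trans (sumF-cong (λ k → trans (cong (_* z k) (z≗0 k)) (zeroˡ (z k)))) (sumF-zero d)
  ... | no z≢0 with ¬∀⟶∃¬ d _ (λ k → z k ≟ 0#) z≢0
  ...   | i , zᵢ≢0 = i , supp , x*x≡1⇒±1 (z i) (trans (sym (·-supportedAt supp z)) z·z≡1)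
    where
    supp : SupportedAt z i
    supp k k≢i with z k ≟ 0#
    ... | yes zₖ≡0 = zₖ≡0
    ... | no  zₖ≢0 = ⊥-elim (twoNonzero⇒¬atMost2 z 0<c (k≢i ∘ sym) zᵢ≢0 zₖ≢0 amd)

  signedBasisVector⇒inD2 : ∀ {d} (c : ℝ) {z : Point d} → SignedBasisVector z → InD 2 (U c) z
  signedBasisVector⇒inD2 c {z} (i , supp , ±1) =
    trans (·-supportedAt supp z) (±1⇒x*x≡1 ±1) ,
    (z i * c ∷ z i * - c ∷ [] , s≤s (s≤s z≤n) ,
     λ s → subst (_∈ z i * c ∷ z i * - c ∷ []) (sym (·-supportedAt supp (U c s))) (value (s i)))
    where
    value : ∀ b → z i * (if b then c else - c) ∈ z i * c ∷ z i * - c ∷ []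
    value true  = here refl
    value false = there (here refl)

  e-diag : ∀ {d} (i : Fin d) → e i i ≡ 1#
  e-diag i with i ≟ᶠ i
  ... | yes _   = refl
  ... | no  i≢i = ⊥-elim (i≢i refl)

  e-offDiag : ∀ {d} {i k : Fin d} → k ≢ i → e i k ≡ 0#
  e-offDiag {i = i} {k} k≢i with i ≟ᶠ k
  ... | yes i≡k = ⊥-elim (k≢i (sym i≡k))
  ... | no  _   = refl

  crossPolytope⇒signedBasisVector : ∀ {d} {z : Point d} → InCrossPolytope z → SignedBasisVector z
  crossPolytope⇒signedBasisVector (i , inj₁ z≗e) =
    i , (λ k k≢i → trans (z≗e k) (e-offDiag k≢i)) , inj₁ (trans (z≗e i) (e-diag i))
  crossPolytope⇒signedBasisVector (i , inj₂ z≗-e) =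
    i , (λ k k≢i → trans (z≗-e k) (trans (cong -_ (e-offDiag k≢i)) -0#≈0#)) ,
    inj₂ (trans (z≗-e i) (cong -_ (e-diag i)))

  signedBasisVector⇒crossPolytope : ∀ {d} {z : Point d} → SignedBasisVector z → InCrossPolytope z
  signedBasisVector⇒crossPolytope {z = z} (i , supp , inj₁ zᵢ≡1) = i , inj₁ z≗e
    where
    z≗e : ∀ j → z j ≡ e i j
    z≗e j with i ≟ᶠ j
    ... | yes refl = zᵢ≡1
    ... | no  i≢j  = supp j (i≢j ∘ sym)
  signedBasisVector⇒crossPolytope {z = z} (i , supp , inj₂ zᵢ≡-1) = i , inj₂ z≗-e
    where
    z≗-e : ∀ j → z j ≡ - e i j
    z≗-e j with i ≟ᶠ j
    ... | yes refl = zᵢ≡-1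
    ... | no  i≢j  = trans (supp j (i≢j ∘ sym)) (sym -0#≈0#)

lemma5p3 : (R : RealNumbers) → let open Geometry R in
    (d : ℕ) → 2 ≤ℕ d → (c : ℝ) → 0# < c → c * c * fromℕ d ≡ 1# →
    (z : Fin d → ℝ) →
    (InD 2 (U c) z → InCrossPolytope z) × (InCrossPolytope z → InD 2 (U c) z)
lemma5p3 R d _ c 0<c _ z =
  (λ z∈D₂ → signedBasisVector⇒crossPolytope R (inD2⇒signedBasisVector R 0<c z∈D₂)) ,
  (λ z∈ω → signedBasisVector⇒inD2 R c (crossPolytope⇒signedBasisVector R z∈ω))
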